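{- Let $G$ be a graph, $r$ a positive integer, and $(\vec{H},\ell)$ a directed graph with $(\le\!r)$-length sets. If $(\vec{H},\ell)$ is an $(r-1)$-step fraternal augmentation of $G$, then $(\vec{H},\ell)$ represents $(\le\!r)$-distances in $G$.
   Context: Directed graphs may contain both $(u,v)$ and $(v,u)$. A directed graph $\vec{H}'$ on the same vertex set as $\vec{H}$ is a $1$-step fraternal augmentation of $\vec{H}$ if $E(\vec{H})\subseteq E(\vec{H}')$, for all edges $(x,y),(x,z)\in E(\vec{H})$ with $y\ne z$ at least one of $(y,z),(z,y)$ is in $E(\vec{H}')$, and for each $(y,z)\in E(\vec{H}')\setminus E(\vec{H})$ there is $x\notin\{y,z\}$ with $(x,y),(x,z)\in E(\vec{H})$. A directed graph with $(\le\!r)$-length sets is a pair $(\vec{H},\ell)$ where $\ell$ assigns to each unordered pair $\{u,v\}$ of vertices a subset of $\{1,\dots,r\}$, with $\ell(\{u,v\})=\emptyset$ unless $(u,v)$ or $(v,u)$ is an edge. It is an orientation of $G$ if $G$ is the underlying undirected graph of $\vec{H}$ and $\ell(\{u,v\})=\{1\}$ for each $uv\in E(G)$. $(\vec{H}_1,\ell_1)$ is a $1$-step fraternal augmentation of $(\vec{H},\ell)$ if $\vec{H}_1$ is a $1$-step fraternal augmentation of $\vec{H}$ and for all distinct $u,v$ and $b\in\{1,\dots,r\}$: $b\in\ell_1(\{u,v\})$ iff $b\in\ell(\{u,v\})$ or there are $x\notin\{u,v\}$, $b_1\in\ell(\{x,u\})$, $b_2\in\ell(\{x,v\})$ with $(x,u),(x,v)\in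 E(\vec{H})$ and $b=b_1+b_2$. An $a$-step fraternal augmentation of $G$ is obtained from some orientation of $G$ (with length sets) by applying the $1$-step operation $a$ times. A walk in a directed graph is a sequence $v_0\dots v_t$ with $(v_{i-1},v_i)$ or $(v_i,v_{i-1})$ an edge for each $i$; it is inward-directed if for some $s\in\{0,\dots,t\}$, $(v_i,v_{i+1})$ is an edge for $i<s$ and $(v_i,v_{i-1})$ is an edge for $i>s$. A length $b$ walk in $(\vec{H},\ell)$ is a tuple $(v_0\dots v_t,b_1,\dots,b_t)$ where $v_0\dots v_t$ is a walk in $\vec{H}$, $b_i\in\ell(\{v_{i-1},v_i\})$ and $b=b_1+\dots+b_t$; it is inward-directed if $v_0\dots v_t$ is. $(\vec{H},\ell)$ represents $(\le\!r)$-distances in $G$ if for all $u,v\in V(G)$ at distance $b\le r$ in $G$, $(\vec{H},\ell)$ contains an inward-directed length $b$ walk between $u$ and $v$. -}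

module Defs where

open import Data.Nat using (ℕ; zero; suc; _+_; _≤_; _<_)
open import Data.Fin using (Fin)
open import Data.Product using (Σ; _×_; _,_; ∃-syntax)
open import Data.Sum using (_⊎_)
open import Relation.Nullary using (¬_)
open import Relation.Binary.PropositionalEquality using (_≡_; _≢_)
open import Function.Bundles using (_⇔_)
open import Level using (Level) renaming (suc to lsuc; zero to lzero)

record Graph (n : ℕ) : Set₁ where
  field
    Adj     : Fin n → Fin n → Set
    sym     : ∀ {u v} → Adj u v → Adj v u
    irrefl  : ∀ {u} → ¬ Adj u u

data GWalk {n : ℕ} (G : Graph n) : Fin n → Fin n → ℕ → Set where
  nil  : ∀ {u} → GWalk G u u 0
  cons : ∀ {u w v k} → Graph.Adj G u w → GWalk G w v k → GWalk G u v (suc k)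

Dist : ∀ {n} → Graph n → Fin n → Fin n → ℕ → Set
Dist G u v b = GWalk G u v b × (∀ k → GWalk G u v k → b ≤ k)

-- The length set of the
-- unordered pair {u,v} is the predicate  ℓ u v  (symmetric in u v) on ℕ,
-- contained in {1,…,r}, and empty unless (u,v) or (v,u) is an edge.
record DLS (n r : ℕ) : Set₁ where
  field
    E       : Fin n → Fin n → Set
    ℓ       : Fin n → Fin n → ℕ → Set
    ℓ-sym   : ∀ {u v b} → ℓ u v b → ℓ v u b
    ℓ-range : ∀ {u v b} → ℓ u v b → 1 ≤ b × b ≤ r
    ℓ-edge  : ∀ {u v b} → ℓ u v b → E u v ⊎ E v u

IsOrientation : ∀ {n r} → Graph n → DLS n r → Set
IsOrientation G H =
  (∀ u v → Graph.Adj G u v ⇔ (DLS.E H u v ⊎ DLS.E H v u)) ×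
  (∀ u v → Graph.Adj G u v → ∀ b → DLS.ℓ H u v b ⇔ (b ≡ 1))

IsFratAug : ∀ {n} → (Fin n → Fin n → Set) → (Fin n → Fin n → Set) → Set
IsFratAug {n} E E₁ =
  (∀ {x y} → E x y → E₁ x y) ×
  (∀ {x y z} → E x y → E x z → y ≢ z → E₁ y z ⊎ E₁ z y) ×
  (∀ {y z} → E₁ y z → ¬ E y z →
     ∃[ x ] (x ≢ y × x ≢ z × E x y × E x z))

IsFratAugL : ∀ {n r} → DLS n r → DLS n r → Set
IsFratAugL {n} {r} H H₁ =
  IsFratAug (DLS.E H) (DLS.E H₁) ×
  (∀ u v b → u ≢ v → 1 ≤ b → b ≤ r →
     (DLS.ℓ H₁ u v b ⇔
       (DLS.ℓ H u v b ⊎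
        (∃[ x ] ∃[ b₁ ] ∃[ b₂ ]
           (x ≢ u × x ≢ v × DLS.ℓ H x u b₁ × DLS.ℓ H x v b₂ ×
            DLS.E H x u × DLS.E H x v × b ≡ b₁ + b₂)))))

data IsAugOf {n r : ℕ} (G : Graph n) : ℕ → DLS n r → Set₁ where
  orient : ∀ {H} → IsOrientation G H → IsAugOf G 0 H
  step   : ∀ {a H H₁} → IsAugOf G a H → IsFratAugL H H₁ → IsAugOf G (suc a) H₁

module _ {n r : ℕ} (H : DLS n r) where
  open DLS H

  data BackWalk : Fin n → Fin n → ℕ → Set where
    nil  : ∀ {x} → BackWalk x x 0
    cons : ∀ {x y z c b} → E y x → ℓ x y c → BackWalk y z b → BackWalk x z (c + b)

  -- Inward-directed length-b walks v_0 … v_t: forward edges up to index s,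
  -- then backward edges.
  data InWalk : Fin n → Fin n → ℕ → Set where
    here : ∀ {x z b} → BackWalk x z b → InWalk x z b
    cons : ∀ {x y z c b} → E x y → ℓ x y c → InWalk y z b → InWalk x z (c + b)

RepresentsDist : ∀ {n r} → Graph n → DLS n r → Set
RepresentsDist {n} {r} G H =
  ∀ u v b → Dist G u v b → b ≤ r → InWalk H u v b ⊎ InWalk H v u b

-- Follow a shortest G-walk from u to v through the successive augmentations.
-- Oriented, it has b steps of length 1 and distinct vertices.  Whenever it is
-- not inward-directed it contains a "valley" x ← y → z, and the augmentation
-- adds an edge between x and z carrying the length c₁ + c₂ of the two steps
-- (distinctness makes x, y, z pairwise distinct); replacing the valley by
-- this edge keeps the total length b and removes one step.  So after r − 1
-- augmentations the walk is inward-directed or has at most b − (r − 1) ≤ 1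
-- steps, which is inward-directed as well.
module Submission where

open import Defs
open import Data.Nat using (ℕ; _≤_; _∸_; suc; _+_; s≤s; z≤n)
open import Data.Nat.Properties using (≤-pred; ≤-refl; ≤-trans; m≤m+n; m≤n+m; m+n≤o⇒m≤o; m+n≤o⇒n≤o; +-assoc; +-suc; +-identityʳ; ≤-reflexive; +-cancelʳ-≤; <-irrefl)
open import Data.Fin using (Fin)
open import Data.List using (List; []; _∷_; length)
open import Data.List.Membership.Propositional using (_∈_)
open import Data.List.Relation.Unary.Any using (here; there)
open import Data.List.Relation.Unary.All using (All; []; _∷_)
open import Data.List.Relation.Unary.All.Properties using (¬Any⇒All¬)
open import Data.List.Relation.Unary.AllPairs using ([]; _∷_)
open import Data.List.Relation.Unary.Unique.Propositional using (Unique)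
open import Data.List.Relation.Unary.Linked using (Linked; []; [-]; _∷_; tail; linked?)
open import Data.List.Relation.Binary.Sublist.Propositional using (_⊆_; []; _∷_; _∷ʳ_; ⊆-reflexive)
open import Data.List.Relation.Binary.Sublist.Propositional.Properties using (All-resp-⊆)
open import Data.Product using (Σ; ∃-syntax; _×_; _,_; proj₁; proj₂)
open import Data.Sum using (_⊎_; inj₁; inj₂)
open import Data.Empty using (⊥-elim)
open import Relation.Nullary using (¬_; Dec; yes; no)
open import Relation.Binary.Definitions using (Decidable)
open import Relation.Binary.PropositionalEquality using (_≡_; _≢_; refl; sym; trans; cong; subst)
open import Function.Bundles using (Equivalence)

private
  variable
    n r b c c₁ c₂ j k : ℕ
    u v x y z : Fin n

Unique-resp-⊇ : ∀ {A : Set} {xs ys : List A} → xs ⊆ ys → Unique ys → Unique xs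
Unique-resp-⊇ []         []       = []
Unique-resp-⊇ (_ ∷ʳ p)   (_ ∷ us) = Unique-resp-⊇ p us
Unique-resp-⊇ (refl ∷ p) (a ∷ us) = All-resp-⊆ p a ∷ Unique-resp-⊇ p us

≤1⇒Linked : ∀ {A : Set} {R : A → A → Set} (xs : List A) → length xs ≤ 1 → Linked R xs
≤1⇒Linked []           _               = []
≤1⇒Linked (_ ∷ [])     _               = [-]
≤1⇒Linked (_ ∷ _ ∷ _) (s≤s ())

module _ (G : Graph n) where

  verticesᴳ : GWalk G u v k → List (Fin n)
  verticesᴳ {u = u} nil        = u ∷ []
  verticesᴳ {u = u} (cons _ g) = u ∷ verticesᴳ g

  suffixFrom : (g : GWalk G u v k) → x ∈ verticesᴳ g → ∃[ k′ ] (k′ ≤ k × GWalk G x v k′)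
  suffixFrom nil        (here refl)  = 0 , z≤n , nil
  suffixFrom (cons a g) (here refl)  = _ , ≤-refl , cons a g
  suffixFrom (cons a g) (there x∈g) =
    let k′ , k′≤k , g′ = suffixFrom g x∈g in k′ , ≤-trans k′≤k (m≤n+m _ 1) , g′

  shortest⇒Unique : (g : GWalk G u v k) → (∀ k′ → GWalk G u v k′ → k ≤ k′) → Unique (verticesᴳ g)
  shortest⇒Unique nil        _        = [] ∷ []
  shortest⇒Unique (cons a g) shortest =
    ¬Any⇒All¬ _ u∉g ∷ shortest⇒Unique g (λ k′ g′ → ≤-pred (shortest (suc k′) (cons a g′)))
    where
    u∉g : ¬ _ ∈ verticesᴳ g
    u∉g u∈g = let k′ , k′≤k , g′ = suffixFrom g u∈g
              in <-irrefl refl (≤-trans (shortest k′ g′) k′≤k)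

data Dir : Set where
  forward backward : Dir

-- Inward-directed means forward* backward*, i.e. sorted for forward ⊑ backward.
data _⊑_ : Dir → Dir → Set where
  forward⊑  : ∀ {d} → forward ⊑ d
  backward⊑ : backward ⊑ backward

Inward : List Dir → Set
Inward = Linked _⊑_

_⊑?_ : Decidable _⊑_
forward  ⊑? _        = yes forward⊑
backward ⊑? forward  = no λ ()
backward ⊑? backward = yes backward⊑

inward? : (ds : List Dir) → Dec (Inward ds)
inward? = linked? _⊑?_

module _ {n r : ℕ} (H : DLS n r) where
  open DLS H

  Step : Dir → Fin n → Fin n → ℕ → Set
  Step forward  x y c = E x y × ℓ x y c
  Step backward x y c = E y x × ℓ x y c

  data Walk : Fin n → Fin n → List Dir → ℕ → Set where
    []  : Walk x x [] 0
    _∷_ : ∀ {d ds} → Step d x y c → Walk y z ds b → Walk x z (d ∷ ds) (c + b)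

module _ {H : DLS n r} where

  vertices : ∀ {ds} → Walk H x z ds b → List (Fin n)
  vertices {x = x} []      = x ∷ []
  vertices {x = x} (_ ∷ w) = x ∷ vertices w

  ≢source : ∀ {ds} (w : Walk H y z ds b) → All (x ≢_) (vertices w) → x ≢ y
  ≢source []      (x≢y ∷ _) = x≢y
  ≢source (_ ∷ _) (x≢y ∷ _) = x≢y

  vertices-subst : ∀ {ds b′} (eq : b ≡ b′) (w : Walk H x z ds b) →
                   vertices (subst (Walk H x z ds) eq w) ≡ vertices w
  vertices-subst refl w = refl

  toBackWalk : ∀ {ds} → Walk H x z ds b → Inward (backward ∷ ds) → BackWalk H x z b
  toBackWalk []                             _               = nil
  toBackWalk (_∷_ {d = backward} (e , l) w) (backward⊑ ∷ i) = cons e l (toBackWalk w i)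

  toInWalk : ∀ {ds} → Walk H x z ds b → Inward ds → InWalk H x z b
  toInWalk []                             _ = here nil
  toInWalk (_∷_ {d = forward}  (e , l) w) i = cons e l (toInWalk w (tail i))
  toInWalk (_∷_ {d = backward} (e , l) w) i = here (cons e l (toBackWalk w i))

module _ {G : Graph n} {H : DLS n r} (o : IsOrientation G H) where

  orientStep : Graph.Adj G x y → Σ Dir λ d → Step H d x y 1
  orientStep {x = x} {y} a = direct (Equivalence.to (proj₁ o x y) a)
    where
    length1 : DLS.ℓ H x y 1
    length1 = Equivalence.from (proj₂ o x y a 1) refl
    direct : DLS.E H x y ⊎ DLS.E H y x → Σ Dir λ d → Step H d x y 1
    direct (inj₁ e) = forward  , e , length1
    direct (inj₂ e) = backward , e , length1

  orientWalk : (g : GWalk G u v k) →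
               ∃[ ds ] Σ (Walk H u v ds k) λ w → vertices w ≡ verticesᴳ G g × length ds ≡ k
  orientWalk nil        = [] , [] , refl , refl
  orientWalk (cons a g) =
    let d , s = orientStep a
        ds , w , same-vertices , ds-length = orientWalk g
    in d ∷ ds , s ∷ w , cong (_ ∷_) same-vertices , cong suc ds-length

record ReducedWalk (H : DLS n r) (j : ℕ) (u v : Fin n) (b : ℕ) : Set where
  constructor reduced
  field
    {dirs}          : List Dir
    walk            : Walk H u v dirs b
    unique          : Unique (vertices walk)
    inward-or-short : Inward dirs ⊎ length dirs + j ≤ b

module Augmentation {H H₁ : DLS n r} (fa : IsFratAugL H H₁) where
  open DLS H using (ℓ; ℓ-sym; ℓ-range)
  open DLS H₁ using () renaming (ℓ to ℓ₁)

  ℓ⊆ℓ₁ : x ≢ y → ℓ x y c → ℓ₁ x y c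
  ℓ⊆ℓ₁ {x = x} {y} {c} x≢y l =
    Equivalence.from (proj₂ fa x y c x≢y (proj₁ (ℓ-range l)) (proj₂ (ℓ-range l))) (inj₁ l)

  liftStep : ∀ d → x ≢ y → Step H d x y c → Step H₁ d x y c
  liftStep forward  x≢y (e , l) = proj₁ (proj₁ fa) e , ℓ⊆ℓ₁ x≢y l
  liftStep backward x≢y (e , l) = proj₁ (proj₁ fa) e , ℓ⊆ℓ₁ x≢y l

  lift : ∀ {ds} (w : Walk H x z ds b) → Unique (vertices w) → Walk H₁ x z ds b
  lift []      _              = []
  lift (s ∷ w) (x∉w ∷ w-uniq) = liftStep _ (≢source w x∉w) s ∷ lift w w-uniq

  vertices-lift : ∀ {ds} (w : Walk H x z ds b) (w-uniq : Unique (vertices w)) →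
                  vertices (lift w w-uniq) ≡ vertices w
  vertices-lift []      _            = refl
  vertices-lift (s ∷ w) (_ ∷ w-uniq) = cong (_ ∷_) (vertices-lift w w-uniq)

  fuse : x ≢ y → y ≢ z → x ≢ z → c₁ + c₂ ≤ r →
         Step H backward x y c₁ → Step H forward y z c₂ → Σ Dir λ d → Step H₁ d x z (c₁ + c₂)
  fuse {x = x} {y} {z} {c₁} {c₂} x≢y y≢z x≢z c≤r (e₁ , l₁) (e₂ , l₂) =
    direct (proj₁ (proj₂ (proj₁ fa)) e₁ e₂ x≢z)
    where
    1≤c : 1 ≤ c₁ + c₂
    1≤c = ≤-trans (proj₁ (ℓ-range l₁)) (m≤m+n c₁ c₂)
    fused : ℓ₁ x z (c₁ + c₂)
    fused = Equivalence.from (proj₂ fa x z (c₁ + c₂) x≢z 1≤c c≤r)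
              (inj₂ (y , c₁ , c₂ , (λ y≡x → x≢y (sym y≡x)) , y≢z , ℓ-sym l₁ , l₂ , e₁ , e₂ , refl))
    direct : DLS.E H₁ x z ⊎ DLS.E H₁ z x → Σ Dir λ d → Step H₁ d x z (c₁ + c₂)
    direct (inj₁ e) = forward  , e , fused
    direct (inj₂ e) = backward , e , fused

  record Shortening {ds} (w : Walk H x z ds b) : Set where
    constructor shortening
    field
      {dirs}         : List Dir
      walk           : Walk H₁ x z dirs b
      one-step-fewer : suc (length dirs) ≡ length ds
      vertices⊆      : vertices walk ⊆ vertices w

  prepend : ∀ {d ds} (s : Step H d x y c) {w : Walk H y z ds b} →
            x ≢ y → Shortening w → Shortening (s ∷ w)
  prepend s x≢y (shortening w′ fewer w′⊆w) =
    shortening (liftStep _ x≢y s ∷ w′) (cong suc fewer) (refl ∷ w′⊆w)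

  shorten : ∀ {ds} (w : Walk H x z ds b) → Unique (vertices w) → ¬ Inward ds → b ≤ r → Shortening w
  shorten []       _ not-inward _ = ⊥-elim (not-inward [])
  shorten (_ ∷ []) _ not-inward _ = ⊥-elim (not-inward [-])
  shorten (_∷_ {c = c} {d = forward} s w@(_ ∷ _)) (x∉w ∷ w-uniq) not-inward b≤r =
    prepend s (≢source w x∉w)
      (shorten w w-uniq (λ inward → not-inward (forward⊑ ∷ inward)) (m+n≤o⇒n≤o c b≤r))
  shorten (_∷_ {c = c} {d = backward} s w@(_∷_ {d = backward} _ _)) (x∉w ∷ w-uniq) not-inward b≤r =
    prepend s (≢source w x∉w)
      (shorten w w-uniq (λ inward → not-inward (backward⊑ ∷ inward)) (m+n≤o⇒n≤o c b≤r))
  shorten {x = x} (_∷_ {c = c₁} {d = backward} s₁ (_∷_ {y = z} {c = c₂} {b = b₂} {d = forward} s₂ w))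
          ((x≢y ∷ x∉w) ∷ y∉w ∷ w-uniq) _ b≤r =
    shortening (subst (Walk H₁ x _ _) (+-assoc c₁ c₂ b₂) (proj₂ shortcut ∷ lift w w-uniq)) refl
      (subst (_⊆ _) (sym (vertices-subst (+-assoc c₁ c₂ b₂) _))
        (refl ∷ (_ ∷ʳ ⊆-reflexive (vertices-lift w w-uniq))))
    where
    c≤r : c₁ + c₂ ≤ r
    c≤r = m+n≤o⇒m≤o (c₁ + c₂) (subst (_≤ r) (sym (+-assoc c₁ c₂ b₂)) b≤r)
    shortcut : Σ Dir λ d → Step H₁ d x z (c₁ + c₂)
    shortcut = fuse x≢y (≢source w y∉w) (≢source w x∉w) c≤r s₁ s₂

  reduceOnce : b ≤ r → ReducedWalk H j u v b → ReducedWalk H₁ (suc j) u v b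
  reduceOnce {b = b} {j = j} b≤r (reduced {ds} w w-uniq inward-or-short)
    with inward? ds | inward-or-short
  ... | yes inward    | _           =
    reduced (lift w w-uniq) (subst Unique (sym (vertices-lift w w-uniq)) w-uniq) (inj₁ inward)
  ... | no not-inward | inj₁ inward = ⊥-elim (not-inward inward)
  ... | no not-inward | inj₂ short  =
    let shortening w′ fewer w′⊆w = shorten w w-uniq not-inward b≤r
    in reduced w′ (Unique-resp-⊇ w′⊆w w-uniq)
         (inj₂ (subst (_≤ b) (trans (cong (_+ j) (sym fewer)) (sym (+-suc _ j))) short))

reducedWalk : {G : Graph n} {H : DLS n r} → IsAugOf G j H → Dist G u v b → b ≤ r → ReducedWalk H j u v b
reducedWalk {G = G} (orient o) (g , shortest) _ =
  let _ , w , same-vertices , ds-length = orientWalk o g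
  in reduced w (subst Unique (sym same-vertices) (shortest⇒Unique G g shortest))
       (inj₂ (≤-reflexive (trans (+-identityʳ _) ds-length)))
reducedWalk (step aug fa) dist b≤r = Augmentation.reduceOnce fa b≤r (reducedWalk aug dist b≤r)

mainTheorem4 : ∀ {n} (G : Graph n) (r : ℕ) → 1 ≤ r → (H : DLS n r) →
    IsAugOf G (r ∸ 1) H → RepresentsDist G H
mainTheorem4 G (suc r′) _ H aug u v b dist b≤r with reducedWalk aug dist b≤r
... | reduced w _ (inj₁ inward) = inj₁ (toInWalk w inward)
... | reduced w _ (inj₂ short)  = inj₁ (toInWalk w (≤1⇒Linked _ (+-cancelʳ-≤ r′ _ 1 (≤-trans short b≤r))))
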